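{- Let $m$ be a non-negative integer and let $S=(u_0,\dots,u_{n-1})$ be an antisymmetric finite sequence of elements of $\mathbb{Z}/m\mathbb{Z}$. Then the Steinhaus triangle with first row $S$ and the triangle $\nabla S$ have the same multiplicity function.
   Context: $S$ is antisymmetric if $u_{n-1-j}=-u_j$ for all $j$. The Steinhaus triangle with first row $S$ is $(b_{i,j})_{i,j\ge0,\,i+j<n}$ with $b_{0,j}=u_j$ and $b_{i,j}=b_{i-1,j}+b_{i-1,j+1}$ for $i\ge1$; the triangle $\nabla S$ is $(a_{i,j})_{i,j\ge0,\,i+j<n}$ with $a_{0,j}=u_j$ and $a_{i,j}=-a_{i-1,j}-a_{i-1,j+1}$ for $i\ge1$. The multiplicity function of a triangle assigns to each $x\in\mathbb{Z}/m\mathbb{Z}$ the number of its entries equal to $x$. -}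

module Defs where

open import Data.Nat as ℕ using (ℕ; zero; suc; _∸_; _<_)
open import Data.Nat.Divisibility using (_∣?_)
import Data.Nat.Divisibility as ℕᵈ
open import Data.Integer as ℤ using (ℤ; ∣_∣)
open import Relation.Nullary.Decidable using (Dec; yes; no)

-- Elements of ℤ/mℤ are represented by integers; two integers represent the
-- same class iff they are congruent modulo m (for m = 0 this is equality).
_≡_[mod_] : ℤ → ℤ → ℕ → Set
x ≡ y [mod m ] = m ℕᵈ.∣ ∣ x ℤ.- y ∣

_≡?_[mod_] : (x y : ℤ) (m : ℕ) → Dec (x ≡ y [mod m ])
x ≡? y [mod m ] = m ∣? ∣ x ℤ.- y ∣

-- A finite sequence S = (u_0,…,u_{n-1}) is given by its length n and a
-- function u : ℕ → ℤ of which only the values u 0, …, u (n-1) matter.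
Antisymmetric : (m n : ℕ) → (ℕ → ℤ) → Set
Antisymmetric m n u = ∀ j → j < n → u (n ∸ 1 ∸ j) ≡ ℤ.- u j [mod m ]

steinhaus : (ℕ → ℤ) → ℕ → ℕ → ℤ
steinhaus u zero    j = u j
steinhaus u (suc i) j = steinhaus u i j ℤ.+ steinhaus u i (suc j)

nabla : (ℕ → ℤ) → ℕ → ℕ → ℤ
nabla u zero    j = u j
nabla u (suc i) j = ℤ.- nabla u i j ℤ.- nabla u i (suc j)

countBelow : ℕ → (ℕ → ℤ) → ℤ → ℕ → ℕ
countBelow zero    f x m = 0
countBelow (suc k) f x m with f k ≡? x [mod m ]
... | yes _ = suc (countBelow k f x m)
... | no  _ = countBelow k f x m

-- number of entries (i,j), i + j < n, of the triangle t (over ℤ/mℤ) equal to x.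
-- Row i (i < n) has the entries t i 0, …, t i (n-1-i).
multiplicityRows : ℕ → ℕ → (ℕ → ℕ → ℤ) → ℕ → ℤ → ℕ
multiplicityRows zero    n t m x = 0
multiplicityRows (suc i) n t m x =
  countBelow (n ∸ i) (t i) x m ℕ.+ multiplicityRows i n t m x

multiplicity : (m n : ℕ) → (ℕ → ℕ → ℤ) → ℤ → ℕ
multiplicity m n t x = multiplicityRows n n t m x

{-# OPTIONS --safe #-}
-- Row i of ∇S is (-1)^i times row i of the Steinhaus triangle of S, and
-- every row of the Steinhaus triangle of an antisymmetric sequence is again
-- antisymmetric. Modulo m, negating an antisymmetric row is the same as
-- reversing it, which does not change how often a residue occurs in it; so
-- the two triangles have the same multiplicities row by row.
module Submission where

open import Defs
open import Data.Nat using (ℕ)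
open import Data.Integer using (ℤ)
open import Relation.Binary.PropositionalEquality using (_≡_)

open import Data.Nat as ℕ using (zero; suc; _∸_; _<_; s≤s)
import Data.Nat.Properties as ℕₚ
open import Data.Nat.Divisibility using (_∣_)
open import Data.Integer using (+_; -_; _+_; _-_; ∣_∣)
import Data.Integer.Properties as ℤₚ
import Data.Integer.Divisibility.Signed as ℤ
open import Data.Integer.Tactic.RingSolver using (solve-∀)
open import Data.Sum using (_⊎_; inj₁; inj₂)
open import Function using (_∘_)
open import Function.Bundles using (_⇔_; mk⇔; module Equivalence)
open import Relation.Binary.PropositionalEquality
  using (refl; sym; trans; cong; cong₂; subst; subst₂; _≗_; module ≡-Reasoning)
open import Relation.Nullary using (yes; no; contradiction)

open Equivalence using (to; from)

-- A wrapper around x ≡ y [mod m ] from which x, y and m can be inferred.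
infix 4 _≋_[mod_]
record _≋_[mod_] (x y : ℤ) (m : ℕ) : Set where
  constructor congruent
  field divides-difference : x ≡ y [mod m ]
open _≋_[mod_]

module _ {m : ℕ} where

  ≋-resp-∣-∣ : ∀ {x y x′ y′} → ∣ x - y ∣ ≡ ∣ x′ - y′ ∣ →
               x ≋ y [mod m ] ⇔ x′ ≋ y′ [mod m ]
  ≋-resp-∣-∣ eq = mk⇔ (λ (congruent d) → congruent (subst (m ∣_) eq d))
                      (λ (congruent d) → congruent (subst (m ∣_) (sym eq) d))

  ≋-sym : ∀ {x y} → x ≋ y [mod m ] → y ≋ x [mod m ]
  ≋-sym {x} {y} = to (≋-resp-∣-∣ (ℤₚ.∣i-j∣≡∣j-i∣ x y))

  neg-≋-neg : ∀ {x y} → - x ≋ - y [mod m ] ⇔ x ≋ y [mod m ]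
  neg-≋-neg {x} {y} = ≋-resp-∣-∣ (begin
    ∣ - x - - y ∣     ≡⟨ cong ∣_∣ (ℤₚ.neg-distrib-+ x (- y)) ⟨
    ∣ - (x - y) ∣     ≡⟨ ℤₚ.∣-i∣≡∣i∣ (x - y) ⟩
    ∣ x - y ∣         ∎)
    where open ≡-Reasoning

  neg-≋ : ∀ {x y} → - x ≋ y [mod m ] ⇔ x ≋ - y [mod m ]
  neg-≋ {x} {y} = ≋-resp-∣-∣ (begin
    ∣ - x - y ∣       ≡⟨ cong (λ z → ∣ - x + z ∣) (ℤₚ.neg-involutive (- y)) ⟨
    ∣ - x - - - y ∣   ≡⟨ cong ∣_∣ (ℤₚ.neg-distrib-+ x (- - y)) ⟨
    ∣ - (x - - y) ∣   ≡⟨ ℤₚ.∣-i∣≡∣i∣ (x - - y) ⟩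
    ∣ x - - y ∣       ∎)
    where open ≡-Reasoning

  ≋⇒∣ : ∀ {x y} → x ≋ y [mod m ] → + m ℤ.∣ x - y
  ≋⇒∣ (congruent d) = ℤ.∣ᵤ⇒∣ d

  ∣⇒≋ : ∀ {x y} → + m ℤ.∣ x - y → x ≋ y [mod m ]
  ∣⇒≋ d = congruent (ℤ.∣⇒∣ᵤ d)

  ≋-trans : ∀ {x y z} → x ≋ y [mod m ] → y ≋ z [mod m ] → x ≋ z [mod m ]
  ≋-trans {x} {y} {z} p q = ∣⇒≋ (subst (+ m ℤ.∣_) (ℤₚ.+-minus-telescope x y z)
                                       (ℤ.∣m∣n⇒∣m+n (≋⇒∣ p) (≋⇒∣ q)))

  ≋-+ : ∀ {a b c d} → a ≋ b [mod m ] → c ≋ d [mod m ] → a + c ≋ b + d [mod m ]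
  ≋-+ {a} {b} {c} {d} p q = ∣⇒≋ (subst (+ m ℤ.∣_) (sym (regroup a b c d))
                                       (ℤ.∣m∣n⇒∣m+n (≋⇒∣ p) (≋⇒∣ q)))
    where
    regroup : ∀ a b c d → (a + c) - (b + d) ≡ (a - b) + (c - d)
    regroup = solve-∀

  countBelow-cong : ∀ L {f g : ℕ → ℤ} {x y : ℤ} →
    (∀ k → k < L → f k ≋ x [mod m ] ⇔ g k ≋ y [mod m ]) →
    countBelow L f x m ≡ countBelow L g y m
  countBelow-cong zero _ = refl
  countBelow-cong (suc L) {f} {g} {x} {y} f⇔g
    with f L ≡? x [mod m ] | g L ≡? y [mod m ]
  ... | yes _  | yes _  = cong suc (countBelow-cong L (λ k → f⇔g k ∘ ℕₚ.m≤n⇒m≤1+n))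
  ... | no _   | no _   = countBelow-cong L (λ k → f⇔g k ∘ ℕₚ.m≤n⇒m≤1+n)
  ... | yes p  | no ¬q  = contradiction (divides-difference (to (f⇔g L ℕₚ.≤-refl) (congruent p))) ¬q
  ... | no ¬p  | yes q  = contradiction (divides-difference (from (f⇔g L ℕₚ.≤-refl) (congruent q))) ¬p

  countBelow-≗ : ∀ L {f g : ℕ → ℤ} {x} → f ≗ g → countBelow L f x m ≡ countBelow L g x m
  countBelow-≗ L {x = x} f≗g =
    countBelow-cong L (λ k _ → ≋-resp-∣-∣ (cong (λ z → ∣ z - x ∣) (f≗g k)))

  countBelow-neg : ∀ L (f : ℕ → ℤ) x → countBelow L (-_ ∘ f) x m ≡ countBelow L f (- x) m
  countBelow-neg L f x = countBelow-cong L (λ _ _ → neg-≋)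

  countBelow-suc : ∀ L (f : ℕ → ℤ) x →
    countBelow (suc L) f x m ≡ countBelow 1 f x m ℕ.+ countBelow L (f ∘ suc) x m
  countBelow-suc zero    f x = sym (ℕₚ.+-identityʳ _)
  countBelow-suc (suc L) f x with f (suc L) ≡? x [mod m ]
  ... | yes _ = trans (cong suc (countBelow-suc L f x)) (sym (ℕₚ.+-suc _ _))
  ... | no _  = countBelow-suc L f x

  countBelow-reverse : ∀ L (f : ℕ → ℤ) x → countBelow L f x m ≡ countBelow L (λ k → f (L ∸ 1 ∸ k)) x m
  countBelow-reverse zero    f x = refl
  countBelow-reverse (suc L) f x = begin
    countBelow (suc L) f x m                             ≡⟨ split-last ⟩
    fL ℕ.+ countBelow L f x m                            ≡⟨ cong (fL ℕ.+_) reversed ⟩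
    fL ℕ.+ countBelow L (λ k → f (L ∸ suc k)) x m        ≡⟨ countBelow-suc L (λ k → f (L ∸ k)) x ⟨
    countBelow (suc L) (λ k → f (L ∸ k)) x m             ∎
    where
    open ≡-Reasoning
    fL : ℕ
    fL = countBelow 1 (λ k → f (L ∸ k)) x m
    split-last : countBelow (suc L) f x m ≡ fL ℕ.+ countBelow L f x m
    split-last with f L ≡? x [mod m ]
    ... | yes _ = refl
    ... | no _  = refl
    reversed : countBelow L f x m ≡ countBelow L (λ k → f (L ∸ suc k)) x m
    reversed = trans (countBelow-reverse L f x) (countBelow-≗ L (cong f ∘ ℕₚ.∸-+-assoc L 1))

  countBelow-neg-antisymmetric : ∀ {L} b → Antisymmetric m L b → ∀ x →
    countBelow L (-_ ∘ b) x m ≡ countBelow L b x m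
  countBelow-neg-antisymmetric {L} b anti x = begin
    countBelow L (-_ ∘ b) x m                   ≡⟨ countBelow-neg L b x ⟩
    countBelow L b (- x) m                      ≡⟨ countBelow-reverse L b (- x) ⟩
    countBelow L (λ k → b (L ∸ 1 ∸ k)) (- x) m  ≡⟨ countBelow-cong L mirrored ⟩
    countBelow L b x m                          ∎
    where
    open ≡-Reasoning
    mirrored : ∀ k → k < L → b (L ∸ 1 ∸ k) ≋ - x [mod m ] ⇔ b k ≋ x [mod m ]
    mirrored k k<L = mk⇔ (λ p → to neg-≋-neg (≋-trans (≋-sym antiₖ) p))
                         (λ q → ≋-trans antiₖ (from neg-≋-neg q))
      where
      antiₖ : b (L ∸ 1 ∸ k) ≋ - b k [mod m ]
      antiₖ = congruent (anti k k<L)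

antisymmetric-pairwise-sums : ∀ {m L} b → Antisymmetric m L b →
  Antisymmetric m (L ∸ 1) (λ j → b j + b (suc j))
antisymmetric-pairwise-sums {m} {suc (suc k)} b anti j (s≤s j≤k) =
  divides-difference (subst₂ (λ y z → y ≋ z [mod m ]) left right (≋-+ outer inner))
  where
  outer : b (k ∸ j) ≋ - b (suc j) [mod m ]
  outer = congruent (anti (suc j) (s≤s (s≤s j≤k)))
  inner : b (suc k ∸ j) ≋ - b j [mod m ]
  inner = congruent (anti j (s≤s (ℕₚ.m≤n⇒m≤1+n j≤k)))
  left : b (k ∸ j) + b (suc k ∸ j) ≡ b (k ∸ j) + b (suc (k ∸ j))
  left = cong (λ i → b (k ∸ j) + b i) (ℕₚ.+-∸-assoc 1 j≤k)
  right : - b (suc j) + - b j ≡ - (b j + b (suc j))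
  right = trans (ℤₚ.+-comm (- b (suc j)) (- b j)) (sym (ℤₚ.neg-distrib-+ (b j) (b (suc j))))

steinhaus-antisymmetric : ∀ {m n} u → Antisymmetric m n u →
  ∀ i → Antisymmetric m (n ∸ i) (steinhaus u i)
steinhaus-antisymmetric u anti zero = anti
steinhaus-antisymmetric {m} {n} u anti (suc i) =
  subst (λ L → Antisymmetric m L (steinhaus u (suc i))) n∸i∸1≡n∸[1+i]
        (antisymmetric-pairwise-sums (steinhaus u i) (steinhaus-antisymmetric u anti i))
  where
  n∸i∸1≡n∸[1+i] : n ∸ i ∸ 1 ≡ n ∸ suc i
  n∸i∸1≡n∸[1+i] = trans (ℕₚ.∸-+-assoc n i 1) (cong (n ∸_) (ℕₚ.+-comm i 1))

nabla-row-sign : ∀ u i → nabla u i ≗ steinhaus u i ⊎ nabla u i ≗ -_ ∘ steinhaus u i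
nabla-row-sign u zero = inj₁ (λ _ → refl)
nabla-row-sign u (suc i) with nabla-row-sign u i
... | inj₁ same = inj₂ λ j → begin
  - nabla u i j - nabla u i (suc j)              ≡⟨ cong₂ (λ y z → - y - z) (same j) (same (suc j)) ⟩
  - steinhaus u i j - steinhaus u i (suc j)      ≡⟨ ℤₚ.neg-distrib-+ (steinhaus u i j) _ ⟨
  - (steinhaus u i j + steinhaus u i (suc j))    ∎
  where open ≡-Reasoning
... | inj₂ opposite = inj₁ λ j → begin
  - nabla u i j - nabla u i (suc j)              ≡⟨ cong₂ (λ y z → - y - z) (opposite j) (opposite (suc j)) ⟩
  - - steinhaus u i j - - steinhaus u i (suc j)  ≡⟨ cong₂ _+_ (ℤₚ.neg-involutive (steinhaus u i j))
                                                              (ℤₚ.neg-involutive _) ⟩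
  steinhaus u i j + steinhaus u i (suc j)        ∎
  where open ≡-Reasoning

rowCount-steinhaus≡nabla : ∀ {m n} u → Antisymmetric m n u → ∀ i x →
  countBelow (n ∸ i) (steinhaus u i) x m ≡ countBelow (n ∸ i) (nabla u i) x m
rowCount-steinhaus≡nabla {n = n} u anti i x with nabla-row-sign u i
... | inj₁ same     = countBelow-≗ (n ∸ i) (sym ∘ same)
... | inj₂ opposite =
  trans (sym (countBelow-neg-antisymmetric (steinhaus u i) (steinhaus-antisymmetric u anti i) x))
        (countBelow-≗ (n ∸ i) (sym ∘ opposite))

multiplicityRows-cong : ∀ {m n x} {s t : ℕ → ℕ → ℤ} →
  (∀ i → countBelow (n ∸ i) (s i) x m ≡ countBelow (n ∸ i) (t i) x m) →
  ∀ k → multiplicityRows k n s m x ≡ multiplicityRows k n t m x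
multiplicityRows-cong rows zero    = refl
multiplicityRows-cong rows (suc k) = cong₂ ℕ._+_ (rows k) (multiplicityRows-cong rows k)

proposition2 : (m n : ℕ) (u : ℕ → ℤ) → Antisymmetric m n u →
    ∀ (x : ℤ) → multiplicity m n (steinhaus u) x ≡ multiplicity m n (nabla u) x
proposition2 m n u anti x = multiplicityRows-cong (λ i → rowCount-steinhaus≡nabla u anti i x) n
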